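{- Let $n,s,k$ be positive integers with $s < n/2 - 1$ and $k \geq s+2$. Then \[ \max_{U\subset V(C_n^s),\ |U|=k} e(U) \leq \binom{k}{2} - \frac{s+1}{2} \left \lfloor \frac{k}{s+1} \right \rfloor \left (\left \lfloor \frac{k}{s+1}\right \rfloor - 1 \right). \]
   Context: $C_n^s$ is the graph on vertex set $\mathbb{Z}/n\mathbb{Z}$ in which distinct $i,j$ (represented in $\{1,\dots,n\}$) are adjacent iff $\min(|i-j|, n-|i-j|)\le s$; i.e. the $s$-th power of the cycle $C_n$. For a vertex subset $U$, $e(U)$ denotes the number of edges of the induced subgraph on $U$. -}

module Defs where

open import Data.Nat using (ℕ; zero; suc; _+_; _∸_; _≤_; _<_; _⊔_; _⊓_; _≤?_; _<?_)
open import Data.Nat.Base using (∣_-_∣)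
open import Data.Fin using (Fin; toℕ)
open import Data.Fin.Subset using (Subset; _∈_)
open import Data.Fin.Subset.Properties using (_∈?_)
open import Data.List using (List; length; filter; allFin; concatMap; map)
open import Data.Product using (_×_; _,_; proj₁; proj₂)
open import Relation.Nullary using (Dec; ¬_)
open import Relation.Nullary.Decidable using (_×-dec_; ¬?)
open import Relation.Binary.PropositionalEquality using (_≡_)

cycDist : (n : ℕ) → Fin n → Fin n → ℕ
cycDist n i j = ∣ toℕ i - toℕ j ∣ ⊓ (n ∸ ∣ toℕ i - toℕ j ∣)

Adj : (n s : ℕ) → Fin n → Fin n → Set
Adj n s i j = ¬ (toℕ i ≡ toℕ j) × (cycDist n i j ≤ s)

Adj? : (n s : ℕ) → (i j : Fin n) → Dec (Adj n s i j)
Adj? n s i j = ¬? (toℕ i Data.Nat.≟ toℕ j) ×-dec (cycDist n i j ≤? s)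

-- all ordered pairs (i , j) with toℕ i < toℕ j, i.e. unordered pairs of distinct vertices
pairs : (n : ℕ) → List (Fin n × Fin n)
pairs n = filter (λ p → toℕ (proj₁ p) <? toℕ (proj₂ p))
                 (concatMap (λ i → map (λ j → (i , j)) (allFin n)) (allFin n))

edgesIn : (n s : ℕ) → Subset n → ℕ
edgesIn n s U = length (filter (λ p → (proj₁ p ∈? U) ×-dec ((proj₂ p ∈? U) ×-dec Adj? n s (proj₁ p) (proj₂ p))) (pairs n))

{-# OPTIONS --safe #-}
module Submission where

-- In C_n^s a vertex has at most 2s neighbours, those at cyclic offsets ±1, …, ±s, and a vertex
-- of U has at most |U| − 1 neighbours in U; summing over U gives 2e(U) ≤ k(k − 1) and
-- 2e(U) ≤ 2sk. If q = ⌊k/(s+1)⌋ ≥ 2 then k ≥ (s+1)q ≥ q + 2s, so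
-- (s+1)q(q − 1) ≤ k(q − 1) ≤ k(k − 1) − 2sk; if q ≤ 1 the correction term is 0.

open import Defs
open import Data.Nat using (ℕ; suc; _+_; _*_; _∸_; _≤_; _<_; _/_)
open import Data.Fin.Subset using (Subset; ∣_∣)
open import Relation.Binary.PropositionalEquality using (_≡_)

open import Data.Nat.Properties
open import Level using (Level)
open import Algebra.Properties.Semiring.Sum +-*-semiring
  using (sum-syntax; sum-cong-≗; ∑-comm; ∑-distrib-+; *-distribˡ-sum; *-distribʳ-sum)
open import Data.Bool using (true; false; if_then_else_)
open import Data.Fin using (Fin; zero; suc; toℕ; fromℕ<; splitAt; _↑ˡ_; _↑ʳ_)
open import Data.Fin.Properties using (toℕ<n; toℕ-fromℕ<; splitAt-↑ˡ; splitAt-↑ʳ; nonZeroIndex)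
open import Data.Fin.Subset using (inside; outside; _∈_)
open import Data.Fin.Subset.Properties using (_∈?_)
open import Data.List using (List; []; _∷_; _++_; map; filter; length; concatMap; allFin; tabulate)
open import Data.List.Properties using (map-++; map-∘; map-cong; map-tabulate)
open import Data.Nat using (zero; z≤n; s≤s; NonZero; _%_; _⊓_; _<?_; _≤?_; _≟_; ∣_-_∣)
open import Data.Nat.DivMod using (m/n*n≤m; m<n⇒m%n≡m; [m+n]%n≡m%n)
open import Data.Nat.ListAction using (sum)
open import Data.Nat.ListAction.Properties using (sum-++)
open import Data.Product using (∃-syntax; _×_; _,_; proj₁; proj₂)
open import Data.Sum using (_⊎_; inj₁; inj₂; [_,_]′; swap)
open import Data.Vec using ([]; _∷_)
open import Function using (_∘_; id)
open import Relation.Nullary using (Dec; yes; no; does; ¬_; contradiction)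
open import Relation.Nullary.Decidable using (_×-dec_)
open import Relation.Unary using (Decidable)
open import Relation.Binary.PropositionalEquality
  using (refl; sym; trans; cong; cong₂; subst; module ≡-Reasoning)

private
  variable
    a b p q : Level
    A : Set a
    B : Set b
    P : Set p
    Q : Set q
    m n : ℕ

𝟙 : Dec P → ℕ
𝟙 d = if does d then 1 else 0

𝟙-mono : (P → Q) → (p? : Dec P) (q? : Dec Q) → 𝟙 p? ≤ 𝟙 q?
𝟙-mono f (yes p) (yes q) = ≤-refl
𝟙-mono f (yes p) (no ¬q) = contradiction (f p) ¬q
𝟙-mono f (no _)  q?      = z≤n

𝟙-cong : (P → Q) → (Q → P) → (p? : Dec P) (q? : Dec Q) → 𝟙 p? ≡ 𝟙 q?
𝟙-cong f g p? q? = ≤-antisym (𝟙-mono f p? q?) (𝟙-mono g q? p?)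

𝟙-× : (p? : Dec P) (q? : Dec Q) → 𝟙 (p? ×-dec q?) ≡ 𝟙 p? * 𝟙 q?
𝟙-× (yes _) (yes _) = refl
𝟙-× (yes _) (no _)  = refl
𝟙-× (no _)  q?      = refl

𝟙-< : ¬ P → Q → (p? : Dec P) (q? : Dec Q) → 𝟙 p? < 𝟙 q?
𝟙-< ¬p q (yes p) q?       = contradiction p ¬p
𝟙-< ¬p q (no _)  (yes _)  = ≤-refl
𝟙-< ¬p q (no _)  (no ¬q)  = contradiction q ¬q

𝟙-+-disjoint : ¬ (P × Q) → (p? : Dec P) (q? : Dec Q) → 𝟙 p? + 𝟙 q? ≤ 1
𝟙-+-disjoint ¬pq (yes p) (yes q) = contradiction (p , q) ¬pq
𝟙-+-disjoint ¬pq (yes _) (no _)  = ≤-refl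
𝟙-+-disjoint ¬pq (no _)  (yes _) = ≤-refl
𝟙-+-disjoint ¬pq (no _)  (no _)  = z≤n

𝟙-*-disjoint : ¬ (P × Q) → (p? : Dec P) (q? : Dec Q) (x : ℕ) → 𝟙 p? * x + 𝟙 q? * x ≤ x
𝟙-*-disjoint ¬pq p? q? x = begin
  𝟙 p? * x + 𝟙 q? * x  ≡⟨ *-distribʳ-+ x (𝟙 p?) (𝟙 q?) ⟨
  (𝟙 p? + 𝟙 q?) * x    ≤⟨ *-monoˡ-≤ x (𝟙-+-disjoint ¬pq p? q?) ⟩
  1 * x                ≡⟨ *-identityˡ x ⟩
  x                    ∎
  where open ≤-Reasoning

∑-mono-≤ : {f g : Fin n → ℕ} → (∀ i → f i ≤ g i) → ∑[ i < n ] f i ≤ ∑[ i < n ] g i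
∑-mono-≤ {zero}  f≤g = z≤n
∑-mono-≤ {suc n} f≤g = +-mono-≤ (f≤g zero) (∑-mono-≤ (f≤g ∘ suc))

∑-mono-< : {f g : Fin n → ℕ} (i : Fin n) → (∀ j → f j ≤ g j) → f i < g i →
           ∑[ j < n ] f j < ∑[ j < n ] g j
∑-mono-< zero    f≤g fi<gi = +-mono-<-≤ fi<gi (∑-mono-≤ (f≤g ∘ suc))
∑-mono-< (suc i) f≤g fi<gi = +-mono-≤-< (f≤g zero) (∑-mono-< i (f≤g ∘ suc) fi<gi)

f≤∑f : (f : Fin n → ℕ) (i : Fin n) → f i ≤ ∑[ j < n ] f j
f≤∑f f zero    = m≤m+n (f zero) _
f≤∑f f (suc i) = ≤-trans (f≤∑f (f ∘ suc) i) (m≤n+m _ (f zero))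

∑1≡n : ∀ n → ∑[ i < n ] 1 ≡ n
∑1≡n zero    = refl
∑1≡n (suc n) = cong suc (∑1≡n n)

∑𝟙≟≤1 : ∀ n x → ∑[ j < n ] 𝟙 (toℕ j ≟ x) ≤ 1
∑𝟙≟≤1 zero    x       = z≤n
∑𝟙≟≤1 (suc n) zero    = ≤-reflexive (cong suc (∑0≡0 n))
  where
  ∑0≡0 : ∀ n → ∑[ j < n ] 𝟙 (suc (toℕ j) ≟ 0) ≡ 0
  ∑0≡0 zero    = refl
  ∑0≡0 (suc n) = ∑0≡0 n
∑𝟙≟≤1 (suc n) (suc x) = ∑𝟙≟≤1 n x

∑𝟙≤cover-size : {P : Fin n → Set p} (P? : Decidable P) (f : Fin m → ℕ) →
                (∀ j → P j → ∃[ v ] toℕ j ≡ f v) → ∑[ j < n ] 𝟙 (P? j) ≤ m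
∑𝟙≤cover-size {n} {m = m} P? f cover = begin
  ∑[ j < n ] 𝟙 (P? j)                       ≤⟨ ∑-mono-≤ {n} covered ⟩
  ∑[ j < n ] ∑[ v < m ] 𝟙 (toℕ j ≟ f v)     ≡⟨ ∑-comm {n} {m} (λ j v → 𝟙 (toℕ j ≟ f v)) ⟩
  ∑[ v < m ] ∑[ j < n ] 𝟙 (toℕ j ≟ f v)     ≤⟨ ∑-mono-≤ {m} (λ v → ∑𝟙≟≤1 n (f v)) ⟩
  ∑[ v < m ] 1                              ≡⟨ ∑1≡n m ⟩
  m                                         ∎
  where
  open ≤-Reasoning
  covered : ∀ j → 𝟙 (P? j) ≤ ∑[ v < m ] 𝟙 (toℕ j ≟ f v)
  covered j with P? j
  ... | no _  = z≤n
  ... | yes pj with v , j≡fv ← cover j pj =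
    ≤-trans (𝟙-mono (λ _ → j≡fv) (yes pj) (toℕ j ≟ f v)) (f≤∑f _ v)

∑𝟙∈≡∣∣ : (U : Subset n) → ∑[ i < n ] 𝟙 (i ∈? U) ≡ ∣ U ∣
∑𝟙∈≡∣∣ {zero}  []            = refl
∑𝟙∈≡∣∣ {suc n} (inside ∷ U)  = cong suc (∑𝟙∈≡∣∣ U)
∑𝟙∈≡∣∣ {suc n} (outside ∷ U) = ∑𝟙∈≡∣∣ U

∑𝟙∈*≤∣∣* : (U : Subset n) (f : Fin n → ℕ) (M : ℕ) → (∀ i → i ∈ U → f i ≤ M) →
           ∑[ i < n ] (𝟙 (i ∈? U) * f i) ≤ ∣ U ∣ * M
∑𝟙∈*≤∣∣* {n} U f M f≤M = begin
  ∑[ i < n ] (𝟙 (i ∈? U) * f i)   ≤⟨ ∑-mono-≤ {n} bounded ⟩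
  ∑[ i < n ] (𝟙 (i ∈? U) * M)    ≡⟨ *-distribʳ-sum M (λ i → 𝟙 (i ∈? U)) ⟨
  (∑[ i < n ] 𝟙 (i ∈? U)) * M  ≡⟨ cong (_* M) (∑𝟙∈≡∣∣ U) ⟩
  ∣ U ∣ * M                     ∎
  where
  open ≤-Reasoning
  bounded : ∀ i → 𝟙 (i ∈? U) * f i ≤ 𝟙 (i ∈? U) * M
  bounded i with i ∈? U
  ... | yes i∈U = *-monoʳ-≤ 1 (f≤M i i∈U)
  ... | no _    = z≤n

length-filter≡sum : {P : A → Set p} (P? : Decidable P) (xs : List A) →
                    length (filter P? xs) ≡ sum (map (𝟙 ∘ P?) xs)
length-filter≡sum P? []       = refl
length-filter≡sum P? (x ∷ xs) with does (P? x)
... | true  = cong suc (length-filter≡sum P? xs)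
... | false = length-filter≡sum P? xs

sum-map-filter : {P : A → Set p} (P? : Decidable P) (f : A → ℕ) (xs : List A) →
                 sum (map f (filter P? xs)) ≡ sum (map (λ x → 𝟙 (P? x) * f x) xs)
sum-map-filter P? f []       = refl
sum-map-filter P? f (x ∷ xs) with does (P? x)
... | true  = cong₂ _+_ (sym (+-identityʳ (f x))) (sum-map-filter P? f xs)
... | false = sum-map-filter P? f xs

sum-map-concatMap : (f : B → ℕ) (g : A → List B) (xs : List A) →
                    sum (map f (concatMap g xs)) ≡ sum (map (sum ∘ map f ∘ g) xs)
sum-map-concatMap f g []       = refl
sum-map-concatMap f g (x ∷ xs) = begin
  sum (map f (g x ++ concatMap g xs))               ≡⟨ cong sum (map-++ f (g x) _) ⟩
  sum (map f (g x) ++ map f (concatMap g xs))       ≡⟨ sum-++ (map f (g x)) _ ⟩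
  sum (map f (g x)) + sum (map f (concatMap g xs))  ≡⟨ cong (_ +_) (sum-map-concatMap f g xs) ⟩
  sum (map f (g x)) + sum (map (sum ∘ map f ∘ g) xs) ∎
  where open ≡-Reasoning

sum-tabulate : (f : Fin n → ℕ) → sum (tabulate f) ≡ ∑[ i < n ] f i
sum-tabulate {zero}  f = refl
sum-tabulate {suc n} f = cong (f zero +_) (sum-tabulate (f ∘ suc))

sum-map-allFin : (f : Fin n → ℕ) → sum (map f (allFin n)) ≡ ∑[ i < n ] f i
sum-map-allFin {n} f = trans (cong sum (map-tabulate id f)) (sum-tabulate f)

sum-map-pairs : (h : Fin n × Fin n → ℕ) →
                sum (map h (concatMap (λ i → map (i ,_) (allFin n)) (allFin n)))
                ≡ ∑[ i < n ] ∑[ j < n ] h (i , j)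
sum-map-pairs {n} h = begin
  sum (map h (concatMap (λ i → map (i ,_) (allFin n)) (allFin n)))
    ≡⟨ sum-map-concatMap h (λ i → map (i ,_) (allFin n)) (allFin n) ⟩
  sum (map (λ i → sum (map h (map (i ,_) (allFin n)))) (allFin n))
    ≡⟨ cong sum (map-cong (λ i → cong sum (sym (map-∘ (allFin n)))) (allFin n)) ⟩
  sum (map (λ i → sum (map (λ j → h (i , j)) (allFin n))) (allFin n))
    ≡⟨ cong sum (map-cong (λ i → sum-map-allFin (λ j → h (i , j))) (allFin n)) ⟩
  sum (map (λ i → ∑[ j < n ] h (i , j)) (allFin n))
    ≡⟨ sum-map-allFin (λ i → ∑[ j < n ] h (i , j)) ⟩
  ∑[ i < n ] ∑[ j < n ] h (i , j) ∎
  where open ≡-Reasoning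

handshake : (h : Fin n → Fin n → ℕ) → (∀ i j → h i j ≡ h j i) →
            2 * ∑[ i < n ] ∑[ j < n ] (𝟙 (toℕ i <? toℕ j) * h i j) ≤ ∑[ i < n ] ∑[ j < n ] h i j
handshake {n} h h-sym = begin
  2 * X
    ≡⟨ cong (X +_) (+-identityʳ X) ⟩
  X + X
    ≡⟨ cong (X +_) (∑-comm {n} {n} (λ i j → 𝟙< i j * h i j)) ⟩
  X + ∑[ i < n ] ∑[ j < n ] (𝟙< j i * h j i)
    ≡⟨ cong (X +_) (sum-cong-≗ (λ i → sum-cong-≗ (λ j → cong (𝟙< j i *_) (h-sym j i)))) ⟩
  X + ∑[ i < n ] ∑[ j < n ] (𝟙< j i * h i j)
    ≡⟨ ∑-distrib-+ (λ i → ∑[ j < n ] (𝟙< i j * h i j)) _ ⟨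
  ∑[ i < n ] (∑[ j < n ] (𝟙< i j * h i j) + ∑[ j < n ] (𝟙< j i * h i j))
    ≡⟨ sum-cong-≗ (λ i → ∑-distrib-+ (λ j → 𝟙< i j * h i j) _) ⟨
  ∑[ i < n ] ∑[ j < n ] (𝟙< i j * h i j + 𝟙< j i * h i j)
    ≤⟨ ∑-mono-≤ {n} (λ i → ∑-mono-≤ {n} (λ j → 𝟙-*-disjoint (λ (i<j , j<i) → <-asym i<j j<i)
                                                 (toℕ i <? toℕ j) (toℕ j <? toℕ i) (h i j))) ⟩
  ∑[ i < n ] ∑[ j < n ] h i j ∎
  where
  open ≤-Reasoning
  𝟙< : Fin n → Fin n → ℕ
  𝟙< i j = 𝟙 (toℕ i <? toℕ j)
  X : ℕ
  X = ∑[ i < n ] ∑[ j < n ] (𝟙< i j * h i j)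

edge? : (n s : ℕ) (U : Subset n) (i j : Fin n) → Dec (i ∈ U × j ∈ U × Adj n s i j)
edge? n s U i j = (i ∈? U) ×-dec ((j ∈? U) ×-dec Adj? n s i j)

degree : (n s : ℕ) → Fin n → ℕ
degree n s i = ∑[ j < n ] 𝟙 (Adj? n s i j)

degreeIn : (n s : ℕ) → Subset n → Fin n → ℕ
degreeIn n s U i = ∑[ j < n ] 𝟙 ((j ∈? U) ×-dec Adj? n s i j)

Adj-sym : ∀ {n s} {i j : Fin n} → Adj n s i j → Adj n s j i
Adj-sym {n} {i = i} {j} (i≢j , dist≤s) =
  i≢j ∘ sym , subst (_≤ _) (cong (λ d → d ⊓ (n ∸ d)) (∣-∣-comm (toℕ i) (toℕ j))) dist≤s

edgesIn≡∑∑ : ∀ n s (U : Subset n) →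
             edgesIn n s U ≡ ∑[ i < n ] ∑[ j < n ] (𝟙 (toℕ i <? toℕ j) * 𝟙 (edge? n s U i j))
edgesIn≡∑∑ n s U = begin
  length (filter edge?ᵖ (filter <?ᵖ ordered))
    ≡⟨ length-filter≡sum edge?ᵖ (pairs n) ⟩
  sum (map (𝟙 ∘ edge?ᵖ) (filter <?ᵖ ordered))
    ≡⟨ sum-map-filter <?ᵖ (𝟙 ∘ edge?ᵖ) ordered ⟩
  sum (map (λ p → 𝟙 (<?ᵖ p) * 𝟙 (edge?ᵖ p)) ordered)
    ≡⟨ sum-map-pairs (λ p → 𝟙 (<?ᵖ p) * 𝟙 (edge?ᵖ p)) ⟩
  ∑[ i < n ] ∑[ j < n ] (𝟙 (toℕ i <? toℕ j) * 𝟙 (edge? n s U i j)) ∎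
  where
  open ≡-Reasoning
  ordered : List (Fin n × Fin n)
  ordered = concatMap (λ i → map (i ,_) (allFin n)) (allFin n)
  <?ᵖ : Decidable (λ (p : Fin n × Fin n) → toℕ (proj₁ p) < toℕ (proj₂ p))
  <?ᵖ p = toℕ (proj₁ p) <? toℕ (proj₂ p)
  edge?ᵖ : Decidable (λ (p : Fin n × Fin n) → proj₁ p ∈ U × proj₂ p ∈ U × Adj n s (proj₁ p) (proj₂ p))
  edge?ᵖ p = edge? n s U (proj₁ p) (proj₂ p)

2*edgesIn≤∑degreeIn : ∀ n s (U : Subset n) →
                      2 * edgesIn n s U ≤ ∑[ i < n ] (𝟙 (i ∈? U) * degreeIn n s U i)
2*edgesIn≤∑degreeIn n s U = begin
  2 * edgesIn n s U
    ≡⟨ cong (2 *_) (edgesIn≡∑∑ n s U) ⟩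
  2 * ∑[ i < n ] ∑[ j < n ] (𝟙 (toℕ i <? toℕ j) * 𝟙 (edge? n s U i j))
    ≤⟨ handshake (λ i j → 𝟙 (edge? n s U i j)) edge-sym ⟩
  ∑[ i < n ] ∑[ j < n ] 𝟙 (edge? n s U i j)
    ≡⟨ sum-cong-≗ row ⟩
  ∑[ i < n ] (𝟙 (i ∈? U) * degreeIn n s U i) ∎
  where
  open ≤-Reasoning
  edge-sym : ∀ i j → 𝟙 (edge? n s U i j) ≡ 𝟙 (edge? n s U j i)
  edge-sym i j = 𝟙-cong flip flip (edge? n s U i j) (edge? n s U j i)
    where
    flip : ∀ {i j} → i ∈ U × j ∈ U × Adj n s i j → j ∈ U × i ∈ U × Adj n s j i
    flip (i∈U , j∈U , adj) = j∈U , i∈U , Adj-sym adj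
  row : ∀ i → ∑[ j < n ] 𝟙 (edge? n s U i j) ≡ 𝟙 (i ∈? U) * degreeIn n s U i
  row i = trans (sum-cong-≗ (λ j → 𝟙-× (i ∈? U) ((j ∈? U) ×-dec Adj? n s i j)))
                (sym (*-distribˡ-sum (𝟙 (i ∈? U)) (λ j → 𝟙 ((j ∈? U) ×-dec Adj? n s i j))))

degreeIn≤degree : ∀ n s (U : Subset n) i → degreeIn n s U i ≤ degree n s i
degreeIn≤degree n s U i =
  ∑-mono-≤ {n} (λ j → 𝟙-mono proj₂ ((j ∈? U) ×-dec Adj? n s i j) (Adj? n s i j))

degreeIn≤∣U∣∸1 : ∀ n s (U : Subset n) i → i ∈ U → degreeIn n s U i ≤ ∣ U ∣ ∸ 1
degreeIn≤∣U∣∸1 n s U i i∈U = <⇒≤pred (subst (degreeIn n s U i <_) (∑𝟙∈≡∣∣ U)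
  (∑-mono-< i (λ j → 𝟙-mono proj₁ ((j ∈? U) ×-dec Adj? n s i j) (j ∈? U))
              (𝟙-< (λ (_ , i≢i , _) → i≢i refl) i∈U ((i ∈? U) ×-dec Adj? n s i i) (i ∈? U))))

x≡b∨b+n⇒x%n≡b : ∀ {n b x} .{{_ : NonZero n}} → b < n → x ≡ b ⊎ x ≡ b + n → x % n ≡ b
x≡b∨b+n⇒x%n≡b         b<n (inj₁ refl) = m<n⇒m%n≡m b<n
x≡b∨b+n⇒x%n≡b {n} {b} b<n (inj₂ refl) = trans ([m+n]%n≡m%n b n) (m<n⇒m%n≡m b<n)

b≡[a±∣a-b∣]%n : ∀ {n a b} .{{_ : NonZero n}} → a < n → b < n →
               b ≡ (a + ∣ a - b ∣) % n ⊎ b ≡ (a + (n ∸ ∣ a - b ∣)) % n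
b≡[a±∣a-b∣]%n {n} {a} {b} a<n b<n with ≤-total a b
... | inj₁ a≤b = inj₁ (sym (x≡b∨b+n⇒x%n≡b b<n (inj₁ (begin
  a + ∣ a - b ∣  ≡⟨ cong (a +_) (m≤n⇒∣m-n∣≡n∸m a≤b) ⟩
  a + (b ∸ a)    ≡⟨ m+[n∸m]≡n a≤b ⟩
  b              ∎))))
  where open ≡-Reasoning
... | inj₂ b≤a = inj₂ (sym (x≡b∨b+n⇒x%n≡b b<n (inj₂ (begin
  a + (n ∸ ∣ a - b ∣)            ≡⟨ cong (λ d → a + (n ∸ d)) (m≤n⇒∣n-m∣≡n∸m b≤a) ⟩
  a + (n ∸ (a ∸ b))              ≡⟨ cong (_+ (n ∸ (a ∸ b))) (m+[n∸m]≡n b≤a) ⟨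
  b + (a ∸ b) + (n ∸ (a ∸ b))    ≡⟨ +-assoc b (a ∸ b) _ ⟩
  b + ((a ∸ b) + (n ∸ (a ∸ b)))  ≡⟨ cong (b +_) (m+[n∸m]≡n (≤-trans (m∸n≤m a b) (<⇒≤ a<n))) ⟩
  b + n                          ∎))))
  where open ≡-Reasoning

cycDist≤⇒offset : ∀ {n s a b} .{{_ : NonZero n}} → a < n → b < n → ¬ a ≡ b →
                  ∣ a - b ∣ ⊓ (n ∸ ∣ a - b ∣) ≤ s →
                  ∃[ d ] 0 < d × d ≤ s × (b ≡ (a + d) % n ⊎ b ≡ (a + (n ∸ d)) % n)
cycDist≤⇒offset {n} {s} {a} {b} a<n b<n a≢b dist≤s with ⊓-sel ∣ a - b ∣ (n ∸ ∣ a - b ∣)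
... | inj₁ ⊓≡∣a-b∣ =
  ∣ a - b ∣ , n≢0⇒n>0 (a≢b ∘ ∣m-n∣≡0⇒m≡n) , subst (_≤ s) ⊓≡∣a-b∣ dist≤s , b≡[a±∣a-b∣]%n a<n b<n
... | inj₂ ⊓≡n∸∣a-b∣ =
  n ∸ ∣ a - b ∣ , m<n⇒0<n∸m ∣a-b∣<n , subst (_≤ s) ⊓≡n∸∣a-b∣ dist≤s ,
  subst (λ e → b ≡ (a + (n ∸ ∣ a - b ∣)) % n ⊎ b ≡ (a + e) % n) (sym (m∸[m∸n]≡n (<⇒≤ ∣a-b∣<n)))
        (swap (b≡[a±∣a-b∣]%n a<n b<n))
  where
  ∣a-b∣<n : ∣ a - b ∣ < n
  ∣a-b∣<n = ≤-<-trans (∣m-n∣≤m⊔n a b) (⊔-pres-<m a<n b<n)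

offset : ℕ → (s : ℕ) → Fin (s + s) → ℕ
offset n s v = [ (λ u → suc (toℕ u)) , (λ u → n ∸ suc (toℕ u)) ]′ (splitAt s v)

offset-forward : ∀ {n s d} (d<s : d < s) → offset n s (fromℕ< d<s ↑ˡ s) ≡ suc d
offset-forward {s = s} d<s rewrite splitAt-↑ˡ s (fromℕ< d<s) s = cong suc (toℕ-fromℕ< d<s)

offset-backward : ∀ {n s d} (d<s : d < s) → offset n s (s ↑ʳ fromℕ< d<s) ≡ n ∸ suc d
offset-backward {n} {s} d<s rewrite splitAt-↑ʳ s s (fromℕ< d<s) =
  cong (λ e → n ∸ suc e) (toℕ-fromℕ< d<s)

Adj⇒offset : ∀ {n s} .{{_ : NonZero n}} (i j : Fin n) → Adj n s i j →
             ∃[ v ] toℕ j ≡ (toℕ i + offset n s v) % n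
Adj⇒offset {n} {s} i j (i≢j , dist≤s) with cycDist≤⇒offset (toℕ<n i) (toℕ<n j) i≢j dist≤s
... | suc d , _ , d<s , inj₁ j≡ =
  fromℕ< d<s ↑ˡ s , trans j≡ (cong (λ e → (toℕ i + e) % n) (sym (offset-forward {n} d<s)))
... | suc d , _ , d<s , inj₂ j≡ =
  s ↑ʳ fromℕ< d<s , trans j≡ (cong (λ e → (toℕ i + e) % n) (sym (offset-backward {n} d<s)))

degree≤s+s : ∀ n s (i : Fin n) → degree n s i ≤ s + s
degree≤s+s n s i = ∑𝟙≤cover-size (Adj? n s i) (λ v → (toℕ i + offset n s v) % n) (Adj⇒offset i)
  where
  instance
    n≢0 : NonZero n
    n≢0 = nonZeroIndex i

2*edgesIn≤∣U∣* : ∀ n s (U : Subset n) M → (∀ i → i ∈ U → degreeIn n s U i ≤ M) →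
                 2 * edgesIn n s U ≤ ∣ U ∣ * M
2*edgesIn≤∣U∣* n s U M deg≤M =
  ≤-trans (2*edgesIn≤∑degreeIn n s U) (∑𝟙∈*≤∣∣* U (degreeIn n s U) M deg≤M)

2sk+deficit≤k[k∸1] : ∀ k s q → 2 ≤ q → q * suc s ≤ k →
                     k * (s + s) + (s + 1) * q * (q ∸ 1) ≤ k * (k ∸ 1)
2sk+deficit≤k[k∸1] zero    s (suc (suc q)) (s≤s (s≤s z≤n)) ()
2sk+deficit≤k[k∸1] (suc k) s (suc (suc q)) (s≤s (s≤s z≤n)) qs≤k = begin
  suc k * (s + s) + (s + 1) * suc (suc q) * suc q  ≤⟨ +-monoʳ-≤ (suc k * (s + s)) (*-monoˡ-≤ (suc q) [s+1]q≤k) ⟩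
  suc k * (s + s) + suc k * suc q                  ≡⟨ *-distribˡ-+ (suc k) (s + s) (suc q) ⟨
  suc k * (s + s + suc q)                          ≤⟨ *-monoʳ-≤ (suc k) s+s+q≤k ⟩
  suc k * k                                        ∎
  where
  open ≤-Reasoning
  [1+s]q≤k : suc s * suc (suc q) ≤ suc k
  [1+s]q≤k = subst (_≤ suc k) (*-comm (suc (suc q)) (suc s)) qs≤k
  [s+1]q≤k : (s + 1) * suc (suc q) ≤ suc k
  [s+1]q≤k = subst (λ t → t * suc (suc q) ≤ suc k) (+-comm 1 s) [1+s]q≤k
  s+s+q≤k : s + s + suc q ≤ k
  s+s+q≤k = begin
    s + s + suc q            ≡⟨ +-comm (s + s) (suc q) ⟩
    suc q + (s + s)          ≤⟨ +-monoʳ-≤ (suc q) (+-monoʳ-≤ s (m≤m*n s (suc q))) ⟩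
    suc q + (s + s * suc q)  ≡⟨ cong (suc q +_) (*-suc s (suc q)) ⟨
    suc q + s * suc (suc q)  ≤⟨ ≤-pred [1+s]q≤k ⟩
    k                        ∎

E+deficit≤k[k∸1] : ∀ k s E → E ≤ k * (k ∸ 1) → E ≤ k * (s + s) →
                   E + (s + 1) * (k / suc s) * (k / suc s ∸ 1) ≤ k * (k ∸ 1)
E+deficit≤k[k∸1] k s E E≤k[k∸1] E≤2sk with k / suc s ≤? 1
... | yes q≤1 = ≤-trans (≤-reflexive no-deficit) E≤k[k∸1]
  where
  no-deficit : E + (s + 1) * (k / suc s) * (k / suc s ∸ 1) ≡ E
  no-deficit rewrite m≤n⇒m∸n≡0 q≤1 | *-zeroʳ ((s + 1) * (k / suc s)) = +-identityʳ E
... | no q≰1 =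
  ≤-trans (+-monoˡ-≤ _ E≤2sk) (2sk+deficit≤k[k∸1] k s (k / suc s) (≰⇒> q≰1) (m/n*n≤m k (suc s)))

mainTheorem3 : (n s k : ℕ) → 1 ≤ s → 1 ≤ k → 2 * (s + 1) < n → s + 2 ≤ k →
    (U : Subset n) → ∣ U ∣ ≡ k →
    2 * edgesIn n s U + (s + 1) * (k / suc s) * (k / suc s ∸ 1) ≤ k * (k ∸ 1)
mainTheorem3 n s k _ _ _ _ U refl = E+deficit≤k[k∸1] ∣ U ∣ s (2 * edgesIn n s U)
  (2*edgesIn≤∣U∣* n s U (∣ U ∣ ∸ 1) (degreeIn≤∣U∣∸1 n s U))
  (2*edgesIn≤∣U∣* n s U (s + s) (λ i _ → ≤-trans (degreeIn≤degree n s U i) (degree≤s+s n s i)))
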